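{- Let $G$ be a connected graph and let $e=\{a,b\}$ be a cut-edge of $G$. Let $G_a$ and $G_b$ be the connected components of $G$ with the edge $e$ removed (containing $a$ and $b$ respectively). Then for any minimal fort $F$ of $G$ with $a,b\notin F$, either $V(G_a)\cap F=\emptyset$ or $V(G_b)\cap F=\emptyset$.
   Context: A fort of a finite simple graph $G$ is a nonempty set $F\subseteq V(G)$ such that every vertex not in $F$ is adjacent to either zero or at least two vertices of $F$; it is minimal if no proper subset is a fort. -}

module Defs where

open import Data.Nat using (ℕ)
open import Data.Fin using (Fin)
open import Data.Fin.Subset using (Subset; _∈_; _∉_; _⊂_; Nonempty)
open import Data.Product using (_×_; ∃; ∃-syntax; _,_)
open import Data.Sum using (_⊎_)
open import Relation.Nullary using (¬_)
open import Relation.Binary.PropositionalEquality using (_≡_; _≢_)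
open import Relation.Binary.Construct.Closure.ReflexiveTransitive using (Star)

record Graph (n : ℕ) : Set₁ where
  field
    Adj       : Fin n → Fin n → Set
    irrefl    : ∀ u → ¬ Adj u u
    sym       : ∀ {u v} → Adj u v → Adj v u
open Graph public

Reachable : ∀ {n} → (Fin n → Fin n → Set) → Fin n → Fin n → Set
Reachable R = Star R

Connected : ∀ {n} → Graph n → Set
Connected G = ∀ u v → Reachable (Adj G) u v

AdjMinusEdge : ∀ {n} → Graph n → Fin n → Fin n → Fin n → Fin n → Set
AdjMinusEdge G a b u v =
  Adj G u v × ¬ ((u ≡ a × v ≡ b) ⊎ (u ≡ b × v ≡ a))

CutEdge : ∀ {n} → Graph n → Fin n → Fin n → Set
CutEdge G a b =
  Adj G a b × ¬ (∀ u v → Reachable (AdjMinusEdge G a b) u v)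

InComponentMinusEdge : ∀ {n} → Graph n → Fin n → Fin n → Fin n → Fin n → Set
InComponentMinusEdge G a b x v = Reachable (AdjMinusEdge G a b) x v

IsFort : ∀ {n} → Graph n → Subset n → Set
IsFort G F =
  Nonempty F ×
  (∀ v → v ∉ F →
     (∀ u → Adj G v u → u ∉ F)
     ⊎ (∃[ u ] ∃[ w ] (u ≢ w × Adj G v u × u ∈ F × Adj G v w × w ∈ F)))

IsMinimalFort : ∀ {n} → Graph n → Subset n → Set
IsMinimalFort G F = IsFort G F × (∀ F′ → F′ ⊂ F → ¬ IsFort G F′)

{-# OPTIONS --safe #-}
-- If F meets both sides of the cut edge, intersect it with the side of a.
-- Every edge leaving that side is {a, b}, and a, b ∉ F, so the fort
-- condition at any vertex only sees neighbours on its own side: F ∩ V(Gₐ)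
-- is again a fort, and it is a proper subset of F, contradicting minimality.
module Submission where

open import Defs
open import Data.Fin using (Fin; _≟_)
open import Data.Fin.Subset using (Subset; _∈_; _∉_; _∩_; _⊆_; Nonempty; Empty)
open import Data.Fin.Subset.Properties using (_∈?_; nonempty?; p∩q⊆p; p∩q⊆q; x∈p∩q⁺; x∈p∩q⁻)
open import Data.Vec using (tabulate)
open import Data.Vec.Properties using (lookup∘tabulate; []=⇒lookup; lookup⇒[]=)
open import Data.Sum using (_⊎_; inj₁; inj₂; [_,_]′)
open import Data.Product using (_×_; _,_; proj₁; proj₂; ∃-syntax; swap)
open import Data.Empty using (⊥)
open import Function using (id; _∘_)
open import Level using (Level)
open import Relation.Nullary using (yes; no; does; contradiction)
open import Relation.Nullary.Decidable using (_×-dec_; _⊎-dec_; dec-true)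
open import Relation.Unary using (Pred; Decidable)
open import Relation.Binary.PropositionalEquality using (_≡_; _≢_; refl; trans) renaming (sym to ≡-sym)
open import Relation.Binary.Construct.Closure.ReflexiveTransitive using (Star; ε; _◅_; _◅◅_; reverse)

fromDec : ∀ {ℓ : Level} {n} {P : Pred (Fin n) ℓ} → Decidable P → Subset n
fromDec P? = tabulate (does ∘ P?)

module _ {ℓ : Level} {n} {P : Pred (Fin n) ℓ} (P? : Decidable P) where

  ∈-fromDec⁺ : ∀ {x} → P x → x ∈ fromDec P?
  ∈-fromDec⁺ {x} px = lookup⇒[]= x (fromDec P?) (trans (lookup∘tabulate (does ∘ P?) x) (dec-true (P? x) px))

  ∈-fromDec⁻ : ∀ {x} → x ∈ fromDec P? → P x
  ∈-fromDec⁻ {x} x∈ with P? x | trans (≡-sym (lookup∘tabulate (does ∘ P?) x)) ([]=⇒lookup x∈)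
  ... | yes px | _  = px
  ... | no  _  | ()

BoundaryAvoids : ∀ {n} → Graph n → Subset n → Subset n → Set
BoundaryAvoids G A F = ∀ {u v} → Adj G u v → u ∈ A → v ∉ A → u ∉ F × v ∉ F

module _ {n} {G : Graph n} {A F : Subset n} (avoids : BoundaryAvoids G A F) where

  ∈A-toward-F : ∀ {u v} → Adj G u v → u ∈ A → v ∈ F → v ∈ A
  ∈A-toward-F {v = v} adj u∈A v∈F with v ∈? A
  ... | yes v∈A = v∈A
  ... | no  v∉A = contradiction v∈F (proj₂ (avoids adj u∈A v∉A))

  ∈A-from-F : ∀ {u v} → Adj G u v → u ∈ F → u ∈ A → v ∈ A
  ∈A-from-F {v = v} adj u∈F u∈A with v ∈? A
  ... | yes v∈A = v∈A
  ... | no  v∉A = contradiction u∈F (proj₁ (avoids adj u∈A v∉A))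

  IsFort-∩ : IsFort G F → Nonempty (F ∩ A) → IsFort G (F ∩ A)
  IsFort-∩ (_ , outside) nonempty = nonempty , outside∩
    where
    outside∩ : ∀ v → v ∉ F ∩ A →
      (∀ u → Adj G v u → u ∉ F ∩ A)
      ⊎ (∃[ u ] ∃[ w ] (u ≢ w × Adj G v u × u ∈ F ∩ A × Adj G v w × w ∈ F ∩ A))
    outside∩ v v∉F∩A with v ∈? A
    ... | no v∉A = inj₁ λ u adj u∈F∩A →
            let u∈F , u∈A = x∈p∩q⁻ F A u∈F∩A in v∉A (∈A-from-F (sym G adj) u∈F u∈A)
    ... | yes v∈A with outside v (λ v∈F → v∉F∩A (x∈p∩q⁺ (v∈F , v∈A)))
    ...   | inj₁ none = inj₁ λ u adj → none u adj ∘ p∩q⊆p F A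
    ...   | inj₂ (u , w , u≢w , adj-u , u∈F , adj-w , w∈F) =
            inj₂ (u , w , u≢w , adj-u , x∈p∩q⁺ (u∈F , ∈A-toward-F adj-u v∈A u∈F)
                              , adj-w , x∈p∩q⁺ (w∈F , ∈A-toward-F adj-w v∈A w∈F))

  minimalFort-⊆-or-disjoint : IsMinimalFort G F → F ⊆ A ⊎ Empty (F ∩ A)
  minimalFort-⊆-or-disjoint (fort , minimal) with nonempty? (F ∩ A)
  ... | no  empty    = inj₂ empty
  ... | yes nonempty = inj₁ F⊆A
    where
    F⊆A : F ⊆ A
    F⊆A {x} x∈F with x ∈? A
    ... | yes x∈A = x∈A
    ... | no  x∉A = contradiction (IsFort-∩ fort nonempty)
                      (minimal (F ∩ A) (p∩q⊆p F A , x , x∈F , x∉A ∘ p∩q⊆q F A))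

module CutEdgeSides {n} (G : Graph n) (a b : Fin n) where

  private
    _~_ : Fin n → Fin n → Set
    _~_ = AdjMinusEdge G a b

    _⇝_ : Fin n → Fin n → Set
    _⇝_ = Star _~_

    IsCutEdge : Fin n → Fin n → Set
    IsCutEdge u v = (u ≡ a × v ≡ b) ⊎ (u ≡ b × v ≡ a)

  AdjMinusEdge-sym : ∀ {u v} → u ~ v → v ~ u
  AdjMinusEdge-sym (adj , ≢e) = sym G adj , ≢e ∘ [ inj₂ ∘ swap , inj₁ ∘ swap ]′

  cutEdge-or-AdjMinusEdge : ∀ {u v} → Adj G u v → IsCutEdge u v ⊎ u ~ v
  cutEdge-or-AdjMinusEdge {u} {v} adj with ((u ≟ a) ×-dec (v ≟ b)) ⊎-dec ((u ≟ b) ×-dec (v ≟ a))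
  ... | yes e = inj₁ e
  ... | no ≢e = inj₂ (adj , ≢e)

  walk-avoids-or-ends-after-cutEdge : ∀ {u v} → Star (Adj G) u v → u ⇝ v ⊎ (a ⇝ v ⊎ b ⇝ v)
  walk-avoids-or-ends-after-cutEdge ε = inj₁ ε
  walk-avoids-or-ends-after-cutEdge (adj ◅ walk) with walk-avoids-or-ends-after-cutEdge walk
  ... | inj₂ tail = inj₂ tail
  ... | inj₁ w⇝v with cutEdge-or-AdjMinusEdge adj
  ...   | inj₁ (inj₁ (_ , refl)) = inj₂ (inj₂ w⇝v)
  ...   | inj₁ (inj₂ (_ , refl)) = inj₂ (inj₁ w⇝v)
  ...   | inj₂ u~w               = inj₁ (u~w ◅ w⇝v)

  closedUnderAdjMinusEdge⇒boundaryAvoids : {A F : Subset n} →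
    (∀ {u v} → u ~ v → u ∈ A → v ∈ A) → a ∉ F → b ∉ F → BoundaryAvoids G A F
  closedUnderAdjMinusEdge⇒boundaryAvoids closed a∉F b∉F adj u∈A v∉A with cutEdge-or-AdjMinusEdge adj
  ... | inj₁ (inj₁ (refl , refl)) = a∉F , b∉F
  ... | inj₁ (inj₂ (refl , refl)) = b∉F , a∉F
  ... | inj₂ u~v                  = contradiction (closed u~v u∈A) v∉A

  module Sides (connected : Connected G) (cutEdge : CutEdge G a b) where

    reachable-from-a-or-b : ∀ v → a ⇝ v ⊎ b ⇝ v
    reachable-from-a-or-b v = [ inj₁ , id ]′ (walk-avoids-or-ends-after-cutEdge (connected a v))

    sides-disjoint : ∀ {v} → a ⇝ v → b ⇝ v → ⊥
    sides-disjoint a⇝v b⇝v = proj₂ cutEdge λ u v → reverse AdjMinusEdge-sym (from-a u) ◅◅ from-a v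
      where
      from-a : ∀ x → a ⇝ x
      from-a x = [ id , (a⇝v ◅◅ reverse AdjMinusEdge-sym b⇝v) ◅◅_ ]′ (reachable-from-a-or-b x)

    side-of-a? : Decidable (a ⇝_)
    side-of-a? v with reachable-from-a-or-b v
    ... | inj₁ a⇝v = yes a⇝v
    ... | inj₂ b⇝v = no λ a⇝v → sides-disjoint a⇝v b⇝v

    sideₐ : Subset n
    sideₐ = fromDec side-of-a?

    sideₐ-boundaryAvoids : {F : Subset n} → a ∉ F → b ∉ F → BoundaryAvoids G sideₐ F
    sideₐ-boundaryAvoids = closedUnderAdjMinusEdge⇒boundaryAvoids
      λ u~v u∈sideₐ → ∈-fromDec⁺ side-of-a? (∈-fromDec⁻ side-of-a? u∈sideₐ ◅◅ u~v ◅ ε)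

lemma10 : ∀ {n} (G : Graph n) (a b : Fin n) →
    Connected G → CutEdge G a b →
    (F : Subset n) → IsMinimalFort G F → a ∉ F → b ∉ F →
    (∀ v → InComponentMinusEdge G a b a v → v ∉ F)
    ⊎ (∀ v → InComponentMinusEdge G a b b v → v ∉ F)
lemma10 G a b connected cutEdge F minimal a∉F b∉F =
  [ (λ F⊆sideₐ → inj₂ λ v b⇝v v∈F → sides-disjoint (∈-fromDec⁻ side-of-a? (F⊆sideₐ v∈F)) b⇝v)
  , (λ disjoint → inj₁ λ v a⇝v v∈F → disjoint (v , x∈p∩q⁺ (v∈F , ∈-fromDec⁺ side-of-a? a⇝v)))
  ]′ (minimalFort-⊆-or-disjoint {G = G} (sideₐ-boundaryAvoids a∉F b∉F) minimal)
  where open CutEdgeSides.Sides G a b connected cutEdge
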